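{- Let $G=(V,E)$ be a finite simple graph and let $v\in V$. Then \[T(G)-1\leq T(G-v)\leq T(G)+\deg(v)-1,\] where $T(\cdot)$ denotes the tree cover number and $G-v$ is the graph obtained from $G$ by deleting $v$ and all edges incident to it.
   Context: A tree cover of a graph $G$ is a collection of vertex-disjoint simple trees, each occurring as an induced subgraph of $G$, whose union covers all vertices of $G$. The tree cover number $T(G)$ is the minimum cardinality of a tree cover of $G$. $\deg(v)$ is the number of neighbors of $v$. -}

module Defs where

open import Data.Nat using (ℕ; zero; suc; _+_; _≤_)
open import Data.Bool using (Bool; true; false; if_then_else_)
open import Data.Fin using (Fin; zero; suc; inject₁; fromℕ; punchIn)
open import Data.List using (List; map; allFin)
open import Data.Nat.ListAction using (sum)
open import Data.Empty using (⊥)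
open import Data.Product using (Σ; ∃; _×_)
open import Function.Definitions using (Injective; Surjective)
open import Relation.Binary.PropositionalEquality using (_≡_)

record Graph (n : ℕ) : Set where
  field
    adj    : Fin n → Fin n → Bool
    sym    : ∀ u w → adj u w ≡ adj w u
    irrefl : ∀ u → adj u u ≡ false
open Graph public

deg : ∀ {n} → Graph n → Fin n → ℕ
deg {n} G v = sum (map (λ u → if adj G v u then 1 else 0) (allFin n))

delete : ∀ {n} → Graph (suc n) → Fin (suc n) → Graph n
delete G v = record
  { adj    = λ i j → adj G (punchIn v i) (punchIn v j)
  ; sym    = λ i j → sym G (punchIn v i) (punchIn v j)
  ; irrefl = λ i → irrefl G (punchIn v i)
  }

data Walk {n} (G : Graph n) (S : Fin n → Set) : Fin n → Fin n → Set where
  here : ∀ {u} → S u → Walk G S u u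
  step : ∀ {u w x} → S u → adj G u w ≡ true → Walk G S w x → Walk G S u x

InducedConnected : ∀ {n} → Graph n → (Fin n → Set) → Set
InducedConnected G S = ∀ u w → S u → S w → Walk G S u w

-- A cycle of length 3 + m in the subgraph induced by S:
-- distinct vertices f 0, …, f (m+2), all in S, consecutive ones adjacent
-- and the last adjacent to the first.
InducedCycle : ∀ {n} → Graph n → (Fin n → Set) → ℕ → Set
InducedCycle {n} G S m =
  Σ (Fin (suc (suc (suc m))) → Fin n) λ f →
    Injective _≡_ _≡_ f ×
    (∀ i → S (f i)) ×
    (∀ (i : Fin (suc (suc m))) → adj G (f (inject₁ i)) (f (suc i)) ≡ true) ×
    (adj G (f (fromℕ (suc (suc m)))) (f zero) ≡ true)

InducedAcyclic : ∀ {n} → Graph n → (Fin n → Set) → Set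
InducedAcyclic G S = ∀ m → InducedCycle G S m → ⊥

InducedTree : ∀ {n} → Graph n → (Fin n → Set) → Set
InducedTree {n} G S = (∃ λ u → S u) × InducedConnected G S × InducedAcyclic G S

-- A tree cover of G with k trees: a map c assigning each vertex to one of
-- k classes, every class nonempty (c surjective), each class inducing a tree.
-- The classes are vertex-disjoint and cover V by construction.
TreeCover : ∀ {n} → Graph n → ℕ → Set
TreeCover {n} G k =
  Σ (Fin n → Fin k) λ c →
    Surjective _≡_ _≡_ c ×
    (∀ (i : Fin k) → InducedTree G (λ u → c u ≡ i))

IsTreeCoverNumber : ∀ {n} → Graph n → ℕ → Set
IsTreeCoverNumber G t = TreeCover G t × (∀ k → TreeCover G k → t ≤ k)

-- Adding v back as a one-vertex tree turns a tree cover of G - v into one of G, so T(G) ≤ T(G - v) + 1.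
-- Conversely, take a minimum tree cover of G and let Tᵥ be its tree containing v. Deleting v leaves the
-- other trees intact, while Tᵥ - v is a forest each of whose components contains a neighbour of v
-- (the last vertex before reaching v along Tᵥ), so these components number at most deg(v) and
-- T(G - v) ≤ T(G) - 1 + deg(v). Components are identified by their least neighbour of v, which needs
-- reachability inside a vertex set to be decidable.

module Submission where

open import Defs
open import Level using (0ℓ)
open import Data.Nat using (ℕ; zero; suc; _+_; _≤_; _<_; z≤n; s≤s)
open import Data.Nat.Properties
  using (module ≤-Reasoning; ≤-pred; <-≤-trans; ≤-refl; ≤-trans; m≤n⇒m≤1+n; +-comm)
open import Data.Fin as Fin using (Fin; zero; suc; punchIn; punchOut; join; splitAt)
open import Data.Fin.Properties
  using (any?; all?; ¬∀⟶∃¬; suc-injective; punchIn-injective; punchInᵢ≢i; punchIn-punchOut;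
         punchOut-punchIn; punchOut-cong; punchOut-injective; splitAt-join; ≤-antisym)
open import Data.Fin.Subset using (Subset; inside; outside; _∈_; _-_; ∣_∣)
open import Data.Fin.Subset.Properties using (_∈?_; ∣p∣≤n; x∈p⇒∣p-x∣<∣p∣; p─q⊆p; x∈p∧x≢y⇒x∈p-y)
open import Data.Vec as Vec using (_∷_; here; there)
open import Data.Vec.Properties using ([]=⇒lookup; lookup⇒[]=; lookup∘tabulate)
import Data.List as List
open import Data.List.Properties using (map-tabulate)
open import Data.Nat.ListAction using (sum)
open import Data.Bool using (Bool; true; false; if_then_else_) renaming (_≟_ to _≟ᵇ_)
open import Data.Product using (Σ; ∃; _×_; _,_; proj₁; proj₂)
open import Data.Sum using (_⊎_; inj₁; inj₂)
open import Data.Sum.Properties using (inj₁-injective; inj₂-injective)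
open import Data.Empty using (⊥-elim)
open import Function using (_∘_; id)
open import Relation.Nullary using (Dec; yes; no; ¬_; does)
open import Relation.Nullary.Decidable using (map′; _×-dec_; dec-true)
open import Relation.Unary using (Pred; _⊆_; _≐_; _∩_; _⊢_; ｛_｝; Decidable)
open import Relation.Binary.PropositionalEquality
  using (_≡_; _≢_; refl; trans; cong; subst; subst₂) renaming (sym to ≡-sym)

∃-least : ∀ {n} {P : Pred (Fin n) 0ℓ} → Decidable P → ∃ P → ∃ λ w → P w × (∀ {w′} → P w′ → w Fin.≤ w′)
∃-least P? (zero , p₀) = zero , p₀ , λ _ → z≤n
∃-least P? (suc w , pw) with P? zero
... | yes p₀ = zero , p₀ , λ _ → z≤n
... | no ¬p₀ with ∃-least (P? ∘ suc) (w , pw)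
...   | w₀ , pw₀ , least =
  suc w₀ , pw₀ , λ { {zero} p₀ → ⊥-elim (¬p₀ p₀) ; {suc w′} pw′ → s≤s (least pw′) }

join-injective : ∀ m n {i j : Fin m ⊎ Fin n} → join m n i ≡ join m n j → i ≡ j
join-injective m n {i} {j} e = trans (≡-sym (splitAt-join m n i)) (trans (cong (splitAt m) e) (splitAt-join m n j))

punchOut-punchIn′ : ∀ {n} (v : Fin (suc n)) {x} (v≢x : v ≢ punchIn v x) → punchOut v≢x ≡ x
punchOut-punchIn′ v v≢x = trans (punchOut-cong v refl) (punchOut-punchIn v)

rank : ∀ {n} {p : Subset n} {x} → x ∈ p → Fin ∣ p ∣
rank {p = inside  ∷ p} here        = zero
rank {p = inside  ∷ p} (there x∈p) = suc (rank x∈p)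
rank {p = outside ∷ p} (there x∈p) = rank x∈p

rank-cong : ∀ {n} {p : Subset n} {x y} (x∈p : x ∈ p) (y∈p : y ∈ p) → x ≡ y → rank x∈p ≡ rank y∈p
rank-cong {p = inside  ∷ p} here        here        _ = refl
rank-cong {p = inside  ∷ p} (there x∈p) (there y∈p) e = cong suc (rank-cong x∈p y∈p (suc-injective e))
rank-cong {p = outside ∷ p} (there x∈p) (there y∈p) e = rank-cong x∈p y∈p (suc-injective e)

rank-injective : ∀ {n} {p : Subset n} {x y} (x∈p : x ∈ p) (y∈p : y ∈ p) → rank x∈p ≡ rank y∈p → x ≡ y
rank-injective {p = inside  ∷ p} here        here        _ = refl
rank-injective {p = inside  ∷ p} (there x∈p) (there y∈p) e = cong suc (rank-injective x∈p y∈p (suc-injective e))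
rank-injective {p = outside ∷ p} (there x∈p) (there y∈p) e = cong suc (rank-injective x∈p y∈p e)

module _ {n} {G : Graph n} where

  walk-map : ∀ {P Q : Pred (Fin n) 0ℓ} → P ⊆ Q → ∀ {a b} → Walk G P a b → Walk G Q a b
  walk-map f (here s)     = here (f s)
  walk-map f (step s e w) = step (f s) e (walk-map f w)

  walk-head : ∀ {P a b} → Walk G P a b → P a
  walk-head (here s)     = s
  walk-head (step s _ _) = s

  walk-last : ∀ {P a b} → Walk G P a b → P b
  walk-last (here s)     = s
  walk-last (step _ _ w) = walk-last w

  walk-++ : ∀ {P a b c} → Walk G P a b → Walk G P b c → Walk G P a c
  walk-++ (here _)     w′ = w′
  walk-++ (step s e w) w′ = step s e (walk-++ w w′)

  walk-reverse : ∀ {P a b} → Walk G P a b → Walk G P b a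
  walk-reverse (here s) = here s
  walk-reverse (step {u} {w} s e W) =
    walk-++ (walk-reverse W) (step (walk-head W) (trans (sym G w u) e) (here s))

  walk-split : ∀ {P a b} → Walk G P a b → Walk G (λ x → Walk G P a x × Walk G P x b) a b
  walk-split (here s) = here (here s , here s)
  walk-split (step s e W) =
    step (here s , step s e W) e (walk-map (λ (W₁ , W₂) → step s e W₁ , W₂) (walk-split W))

  walk-lastVisit : ∀ {P a b} (w : Fin n) → Walk G P a b →
    Walk G (P ∩ (_≢ w)) a b ⊎ w ≡ b ⊎ ∃ λ x → adj G w x ≡ true × Walk G (P ∩ (_≢ w)) x b
  walk-lastVisit w (here {a} s) with a Fin.≟ w
  ... | yes refl = inj₂ (inj₁ refl)
  ... | no a≢w   = inj₁ (here (s , a≢w))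
  walk-lastVisit w (step {a} {y} s e W) with walk-lastVisit w W
  ... | inj₂ visit = inj₂ visit
  ... | inj₁ W′ with a Fin.≟ w
  ...   | yes refl = inj₂ (inj₂ (y , e , W′))
  ...   | no a≢w   = inj₁ (step (s , a≢w) e W′)

  -- Search from a through a neighbour inside p - a; the fuel bounds the size of p.
  walk∈? : ∀ {k} (p : Subset n) → ∣ p ∣ < k → ∀ a b → Dec (Walk G (_∈ p) a b)
  walk∈? {suc k} p ∣p∣<1+k a b with a ∈? p | a Fin.≟ b
  ... | no a∉p  | _        = no (a∉p ∘ walk-head)
  ... | yes a∈p | yes refl = yes (here a∈p)
  ... | yes a∈p | no a≢b   =
    map′ (λ (x , e , W) → step a∈p e (walk-map (p─q⊆p p _) W)) leave
         (any? λ x → (adj G a x ≟ᵇ true) ×-dec walk∈? (p - a) smaller x b)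
    where
    smaller : ∣ p - a ∣ < k
    smaller = <-≤-trans (x∈p⇒∣p-x∣<∣p∣ a∈p) (≤-pred ∣p∣<1+k)
    leave : Walk G (_∈ p) a b → ∃ λ x → adj G a x ≡ true × Walk G (_∈ p - a) x b
    leave W with walk-lastVisit a W
    ... | inj₁ W′                 = ⊥-elim (proj₂ (walk-head W′) refl)
    ... | inj₂ (inj₁ a≡b)         = ⊥-elim (a≢b a≡b)
    ... | inj₂ (inj₂ (x , e , W′)) = x , e , walk-map (λ (x∈p , x≢a) → x∈p∧x≢y⇒x∈p-y x∈p x≢a) W′

  walk? : ∀ {S : Pred (Fin n) 0ℓ} → Decidable S → ∀ a b → Dec (Walk G S a b)
  walk? {S} S? a b = map′ (walk-map ∈⇒S) (walk-map S⇒∈) (walk∈? σ (s≤s (∣p∣≤n σ)) a b)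
    where
    σ : Subset n
    σ = Vec.tabulate (does ∘ S?)
    does≡ : ∀ {x} → x ∈ σ → does (S? x) ≡ true
    does≡ {x} x∈σ = trans (≡-sym (lookup∘tabulate (does ∘ S?) x)) ([]=⇒lookup x∈σ)
    ∈⇒S : ∀ {x} → x ∈ σ → S x
    ∈⇒S {x} x∈σ with S? x | does≡ x∈σ
    ... | yes s | _ = s
    S⇒∈ : ∀ {x} → S x → x ∈ σ
    S⇒∈ {x} s = lookup⇒[]= x σ (trans (lookup∘tabulate (does ∘ S?) x) (dec-true (S? x) s))

module _ {n} {G : Graph n} where

  InducedCycle-mono : ∀ {P Q : Pred (Fin n) 0ℓ} {m} → P ⊆ Q → InducedCycle G P m → InducedCycle G Q m
  InducedCycle-mono P⊆Q (f , f-inj , f∈P , edges , closing) = f , f-inj , (λ i → P⊆Q (f∈P i)) , edges , closing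

  InducedTree-resp : ∀ {P Q : Pred (Fin n) 0ℓ} → P ≐ Q → InducedTree G P → InducedTree G Q
  InducedTree-resp {P} {Q} (P⊆Q , Q⊆P) ((u , pu) , connected , acyclic) =
    (u , P⊆Q pu) ,
    (λ a b qa qb → walk-map P⊆Q (connected a b (Q⊆P qa) (Q⊆P qb))) ,
    (λ m cycle → acyclic m (InducedCycle-mono {P = Q} {Q = P} Q⊆P cycle))

  singleton-InducedTree : ∀ v → InducedTree G ｛ v ｝
  singleton-InducedTree v =
    (v , refl) , (λ { a b refl refl → here refl }) ,
    λ { m (f , f-inj , f∈v , _) → 0≢1 (f-inj (trans (≡-sym (f∈v zero)) (f∈v (suc zero)))) }
    where
    0≢1 : ∀ {m} → _≢_ {A = Fin (suc (suc m))} zero (suc zero)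
    0≢1 ()

TreeColouring : ∀ {n} {A : Set} → Graph n → (Fin n → A) → Set
TreeColouring G c = ∀ u → InducedTree G (λ x → c x ≡ c u)

module _ {n} {G : Graph n} where

  TreeColouring-kernel : ∀ {A B : Set} {c : Fin n → A} {d : Fin n → B} →
    (∀ {x y} → c x ≡ c y → d x ≡ d y) → (∀ {x y} → d x ≡ d y → c x ≡ c y) →
    TreeColouring G c → TreeColouring G d
  TreeColouring-kernel c⇒d d⇒c trees u = InducedTree-resp (c⇒d , d⇒c) (trees u)

  -- Unused colours are removed one at a time.
  TreeColouring⇒TreeCover : ∀ {N} (c : Fin n → Fin N) → TreeColouring G c → ∃ λ k → k ≤ N × TreeCover G k
  TreeColouring⇒TreeCover {zero} c trees = 0 , z≤n , c , (λ ()) , (λ ())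
  TreeColouring⇒TreeCover {suc N} c trees with all? (λ i → any? (λ u → c u Fin.≟ i))
  ... | yes surjective =
    suc N , ≤-refl , c , (λ i → proj₁ (surjective i) , λ { refl → proj₂ (surjective i) }) ,
    λ i → subst (λ j → InducedTree G (λ x → c x ≡ j)) (proj₂ (surjective i)) (trees (proj₁ (surjective i)))
  ... | no ¬surjective with ¬∀⟶∃¬ (suc N) _ (λ i → any? (λ u → c u Fin.≟ i)) ¬surjective
  ...   | i , unused =
    let k , k≤N , cover =
          TreeColouring⇒TreeCover c′ (TreeColouring-kernel (punchOut-cong i) (punchOut-injective {i = i} _ _) trees)
    in k , m≤n⇒m≤1+n k≤N , cover
    where
    c′ : Fin n → Fin N
    c′ u = punchOut {i = i} {j = c u} (λ i≡cu → unused (u , ≡-sym i≡cu))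

  treeCoverNumber-≤ : ∀ {t N} → IsTreeCoverNumber G t → Σ (Fin n → Fin N) (TreeColouring G) → t ≤ N
  treeCoverNumber-≤ (_ , minimal) (c , trees) with TreeColouring⇒TreeCover c trees
  ... | k , k≤N , cover = ≤-trans (minimal k cover) k≤N

module _ {n} {S : Pred (Fin n) 0ℓ} (S? : Decidable S) {A B : Set}
         (a : ∀ x → ¬ S x → A) (b : ∀ x → S x → B) where

  glue : Fin n → A ⊎ B
  glue x with S? x
  ... | yes s  = inj₂ (b x s)
  ... | no ¬s = inj₁ (a x ¬s)

  glue-TreeColouring : ∀ {G : Graph n} →
    (∀ {x} (p q : ¬ S x) → a x p ≡ a x q) → (∀ {x} (p q : S x) → b x p ≡ b x q) →
    (∀ u ¬su → InducedTree G (λ x → Σ (¬ S x) λ ¬sx → a x ¬sx ≡ a u ¬su)) →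
    (∀ u su → InducedTree G (λ x → Σ (S x) λ sx → b x sx ≡ b u su)) →
    TreeColouring G glue
  glue-TreeColouring a-irr b-irr a-trees b-trees u with S? u
  ... | yes su = InducedTree-resp (to , from) (b-trees u su)
    where
    to : ∀ {x} → Σ (S x) (λ sx → b x sx ≡ b u su) → glue x ≡ inj₂ (b u su)
    to {x} (sx , e) with S? x
    ... | yes sx′ = cong inj₂ (trans (b-irr sx′ sx) e)
    ... | no ¬sx = ⊥-elim (¬sx sx)
    from : ∀ {x} → glue x ≡ inj₂ (b u su) → Σ (S x) (λ sx → b x sx ≡ b u su)
    from {x} e with S? x
    ... | yes sx = sx , inj₂-injective e
  ... | no ¬su = InducedTree-resp (to , from) (a-trees u ¬su)
    where
    to : ∀ {x} → Σ (¬ S x) (λ ¬sx → a x ¬sx ≡ a u ¬su) → glue x ≡ inj₁ (a u ¬su)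
    to {x} (¬sx , e) with S? x
    ... | yes sx = ⊥-elim (¬sx sx)
    ... | no ¬sx′ = cong inj₁ (trans (a-irr ¬sx′ ¬sx) e)
    from : ∀ {x} → glue x ≡ inj₁ (a u ¬su) → Σ (¬ S x) (λ ¬sx → a x ¬sx ≡ a u ¬su)
    from {x} e with S? x
    ... | no ¬sx = ¬sx , inj₁-injective e

neighbours : ∀ {n} → Graph n → Fin n → Subset n
neighbours G v = Vec.tabulate (adj G v)

adj⇒∈neighbours : ∀ {n} (G : Graph n) {v x} → adj G v x ≡ true → x ∈ neighbours G v
adj⇒∈neighbours G {v} {x} e = lookup⇒[]= x (neighbours G v) (trans (lookup∘tabulate (adj G v) x) e)

∣tabulate∣≡sum : ∀ {n} (f : Fin n → Bool) →
  ∣ Vec.tabulate f ∣ ≡ sum (List.tabulate (λ u → if f u then 1 else 0))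
∣tabulate∣≡sum {zero}  f = refl
∣tabulate∣≡sum {suc n} f with f zero
... | true  = cong suc (∣tabulate∣≡sum (f ∘ suc))
... | false = ∣tabulate∣≡sum (f ∘ suc)

∣neighbours∣≡deg : ∀ {n} (G : Graph n) v → ∣ neighbours G v ∣ ≡ deg G v
∣neighbours∣≡deg G v =
  trans (∣tabulate∣≡sum (adj G v)) (cong sum (≡-sym (map-tabulate id (λ u → if adj G v u then 1 else 0))))

module Deletion {n} (G : Graph (suc n)) (v : Fin (suc n)) where

  H : Graph n
  H = delete G v

  walk-punchIn : ∀ {P : Pred (Fin n) 0ℓ} {Q : Pred (Fin (suc n)) 0ℓ} → P ⊆ (punchIn v ⊢ Q) →
    ∀ {a b} → Walk H P a b → Walk G Q (punchIn v a) (punchIn v b)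
  walk-punchIn P⊆Q (here s)     = here (P⊆Q s)
  walk-punchIn P⊆Q (step s e W) = step (P⊆Q s) e (walk-punchIn P⊆Q W)

  walk-punchOut : ∀ {Q : Pred (Fin (suc n)) 0ℓ} → ¬ Q v →
    ∀ {a b} → Walk G Q (punchIn v a) (punchIn v b) → Walk H (punchIn v ⊢ Q) a b
  walk-punchOut {Q} ¬qv W = go W refl refl
    where
    go : ∀ {x y a b} → Walk G Q x y → punchIn v a ≡ x → punchIn v b ≡ y → Walk H (punchIn v ⊢ Q) a b
    go {a = a} (here s) refl eb = subst (Walk H (punchIn v ⊢ Q) a) (≡-sym (punchIn-injective v _ _ eb)) (here s)
    go (step {w = y} s e W) refl eb = step s (subst (λ z → adj G _ z ≡ true) (≡-sym ey) e) (go W ey eb)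
      where
      v≢y : v ≢ y
      v≢y refl = ¬qv (walk-head W)
      ey : punchIn v (punchOut v≢y) ≡ y
      ey = punchIn-punchOut v≢y

  InducedCycle-punchIn : ∀ {P : Pred (Fin n) 0ℓ} {Q : Pred (Fin (suc n)) 0ℓ} {m} → P ⊆ (punchIn v ⊢ Q) →
    InducedCycle H P m → InducedCycle G Q m
  InducedCycle-punchIn P⊆Q (f , f-inj , f∈P , edges , closing) =
    punchIn v ∘ f , f-inj ∘ punchIn-injective v _ _ , (λ i → P⊆Q (f∈P i)) , edges , closing

  InducedCycle-punchOut : ∀ {Q : Pred (Fin (suc n)) 0ℓ} {m} → ¬ Q v →
    InducedCycle G Q m → InducedCycle H (punchIn v ⊢ Q) m
  InducedCycle-punchOut {Q} ¬qv (f , f-inj , f∈Q , edges , closing) =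
    f′ , (λ e → f-inj (trans (≡-sym (f′-eq _)) (trans (cong (punchIn v) e) (f′-eq _)))) ,
    (λ i → subst Q (≡-sym (f′-eq i)) (f∈Q i)) ,
    (λ i → subst₂ (λ x y → adj G x y ≡ true) (≡-sym (f′-eq _)) (≡-sym (f′-eq _)) (edges i)) ,
    subst₂ (λ x y → adj G x y ≡ true) (≡-sym (f′-eq _)) (≡-sym (f′-eq _)) closing
    where
    v≢f : ∀ i → v ≢ f i
    v≢f i v≡fi = ¬qv (subst Q (≡-sym v≡fi) (f∈Q i))
    f′ : _ → Fin n
    f′ i = punchOut (v≢f i)
    f′-eq : ∀ i → punchIn v (f′ i) ≡ f i
    f′-eq i = punchIn-punchOut (v≢f i)

  InducedTree-delete : ∀ {Q : Pred (Fin (suc n)) 0ℓ} → ¬ Q v → InducedTree G Q → InducedTree H (punchIn v ⊢ Q)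
  InducedTree-delete {Q} ¬qv ((u , qu) , connected , acyclic) =
    (punchOut v≢u , subst Q (≡-sym (punchIn-punchOut v≢u)) qu) ,
    (λ a b qa qb → walk-punchOut ¬qv (connected _ _ qa qb)) ,
    (λ m cycle → acyclic m (InducedCycle-punchIn {P = punchIn v ⊢ Q} {Q = Q} (λ q → q) cycle))
    where
    v≢u : v ≢ u
    v≢u refl = ¬qv qu

  InducedTree-undelete : ∀ {Q : Pred (Fin (suc n)) 0ℓ} → ¬ Q v → InducedTree H (punchIn v ⊢ Q) → InducedTree G Q
  InducedTree-undelete {Q} ¬qv ((u , qu) , connected , acyclic) =
    (punchIn v u , qu) ,
    (λ a b qa qb → subst₂ (Walk G Q) (punchIn-punchOut (v≢ qa)) (punchIn-punchOut (v≢ qb))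
      (walk-punchIn (λ q → q) (connected _ _ (subst Q (≡-sym (punchIn-punchOut (v≢ qa))) qa)
                                              (subst Q (≡-sym (punchIn-punchOut (v≢ qb))) qb)))) ,
    (λ m cycle → acyclic m (InducedCycle-punchOut ¬qv cycle))
    where
    v≢ : ∀ {x} → Q x → v ≢ x
    v≢ qx refl = ¬qv qx

extend-TreeColouring : ∀ {n} (G : Graph (suc n)) (v : Fin (suc n)) {k} (c : Fin n → Fin k) →
  TreeColouring (delete G v) c → Σ (Fin (suc n) → Fin (k + 1)) (TreeColouring G)
extend-TreeColouring G v {k} c trees =
  join k 1 ∘ glue (v Fin.≟_) old new ,
  TreeColouring-kernel (cong (join k 1)) (join-injective k 1)
    (glue-TreeColouring (v Fin.≟_) old new (λ _ _ → cong c (punchOut-cong v refl)) (λ _ _ → refl)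
      old-trees (λ _ _ → InducedTree-resp ((λ v≡x → v≡x , refl) , proj₁) (singleton-InducedTree v)))
  where
  open Deletion G v
  old : ∀ x → v ≢ x → Fin k
  old x v≢x = c (punchOut v≢x)
  new : ∀ x → v ≡ x → Fin 1
  new _ _ = zero
  old-trees : ∀ u v≢u → InducedTree G (λ x → Σ (v ≢ x) λ v≢x → old x v≢x ≡ old u v≢u)
  old-trees u v≢u =
    InducedTree-undelete (λ (v≢v , _) → v≢v refl) (InducedTree-resp (to , from) (trees (punchOut v≢u)))
    where
    to : ∀ {x} → c x ≡ c (punchOut v≢u) → Σ (v ≢ punchIn v x) λ v≢x → old _ v≢x ≡ old u v≢u
    to {x} e = punchInᵢ≢i v x ∘ ≡-sym , trans (cong c (punchOut-punchIn v)) e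
    from : ∀ {x} → Σ (v ≢ punchIn v x) (λ v≢x → old _ v≢x ≡ old u v≢u) → c x ≡ c (punchOut v≢u)
    from (v≢x , e) = trans (cong c (≡-sym (punchOut-punchIn′ v v≢x))) e

module Restriction {n} (G : Graph (suc n)) (v : Fin (suc n)) {k} (c : Fin (suc n) → Fin (suc k))
                   (trees : TreeColouring G c) where
  open Deletion G v

  InTreeOfV : Pred (Fin n) 0ℓ
  InTreeOfV x = c (punchIn v x) ≡ c v

  InTreeOfV? : Decidable InTreeOfV
  InTreeOfV? x = c (punchIn v x) Fin.≟ c v

  outer : ∀ x → ¬ InTreeOfV x → Fin k
  outer x ∉Tᵥ = punchOut (∉Tᵥ ∘ ≡-sym)

  outer-trees : ∀ u ∉Tᵥ → InducedTree H (λ x → Σ (¬ InTreeOfV x) λ ∉Tᵥ′ → outer x ∉Tᵥ′ ≡ outer u ∉Tᵥ)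
  outer-trees u ∉Tᵥ = InducedTree-resp (to , from) (InducedTree-delete (∉Tᵥ ∘ ≡-sym) (trees (punchIn v u)))
    where
    to : ∀ {x} → c (punchIn v x) ≡ c (punchIn v u) →
         Σ (¬ InTreeOfV x) λ ∉Tᵥ′ → outer x ∉Tᵥ′ ≡ outer u ∉Tᵥ
    to e = (λ ∈Tᵥ → ∉Tᵥ (trans (≡-sym e) ∈Tᵥ)) , punchOut-cong (c v) e
    from : ∀ {x} → Σ (¬ InTreeOfV x) (λ ∉Tᵥ′ → outer x ∉Tᵥ′ ≡ outer u ∉Tᵥ) →
           c (punchIn v x) ≡ c (punchIn v u)
    from (_ , e) = punchOut-injective {i = c v} _ _ e

  Reaches : Fin n → Fin n → Set
  Reaches u w = adj G v (punchIn v w) ≡ true × Walk H InTreeOfV w u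

  -- In the tree of v, the walk from v to u leaves v for the last time through a neighbour of v.
  reaches-some : ∀ {u} → InTreeOfV u → ∃ (Reaches u)
  reaches-some {u} ∈Tᵥ with walk-lastVisit v (proj₁ (proj₂ (trees v)) v (punchIn v u) refl ∈Tᵥ)
  ... | inj₁ W               = ⊥-elim (proj₂ (walk-head W) refl)
  ... | inj₂ (inj₁ v≡u)      = ⊥-elim (punchInᵢ≢i v u (≡-sym v≡u))
  ... | inj₂ (inj₂ (x , e , W)) =
    punchOut v≢x , subst (λ y → adj G v y ≡ true) (≡-sym x-eq) e ,
    walk-map proj₁ (walk-punchOut (λ (_ , v≢v) → v≢v refl)
                                  (subst (λ y → Walk G _ y (punchIn v u)) (≡-sym x-eq) W))
    where
    v≢x : v ≢ x
    v≢x v≡x = proj₂ (walk-head W) (≡-sym v≡x)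
    x-eq : punchIn v (punchOut v≢x) ≡ x
    x-eq = punchIn-punchOut v≢x

  least-reaching : ∀ {u} → InTreeOfV u → ∃ λ w → Reaches u w × (∀ {w′} → Reaches u w′ → w Fin.≤ w′)
  least-reaching {u} ∈Tᵥ =
    ∃-least (λ w → (adj G v (punchIn v w) ≟ᵇ true) ×-dec walk? InTreeOfV? w u) (reaches-some ∈Tᵥ)

  label : ∀ {u} → InTreeOfV u → Fin n
  label ∈Tᵥ = proj₁ (least-reaching ∈Tᵥ)

  label-reaches : ∀ {u} (∈Tᵥ : InTreeOfV u) → Reaches u (label ∈Tᵥ)
  label-reaches ∈Tᵥ = proj₁ (proj₂ (least-reaching ∈Tᵥ))

  label-least : ∀ {u w} (∈Tᵥ : InTreeOfV u) → Reaches u w → label ∈Tᵥ Fin.≤ w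
  label-least ∈Tᵥ = proj₂ (proj₂ (least-reaching ∈Tᵥ))

  label-irrelevant : ∀ {u} (p q : InTreeOfV u) → label p ≡ label q
  label-irrelevant p q = ≤-antisym (label-least p (label-reaches q)) (label-least q (label-reaches p))

  Component : Fin n → Pred (Fin n) 0ℓ
  Component w x = Σ (InTreeOfV x) λ ∈Tᵥ → label ∈Tᵥ ≡ w

  -- Every vertex y on a walk from w to x ∈ Component w is reached from w, so label y ≤ w,
  -- and reaches x, so w = label x ≤ label y.
  component-walk : ∀ {w x} → Component w x → Walk H (Component w) w x
  component-walk {w} {x} (∈Tᵥ , refl) = walk-map on-path (walk-split (proj₂ (label-reaches ∈Tᵥ)))
    where
    on-path : ∀ {y} → Walk H InTreeOfV w y × Walk H InTreeOfV y x → Component w y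
    on-path (W₁ , W₂) =
      let ∈Tᵥ′ = walk-last W₁ in
      ∈Tᵥ′ ,
      ≤-antisym (label-least ∈Tᵥ′ (proj₁ (label-reaches ∈Tᵥ) , W₁))
                (label-least ∈Tᵥ (proj₁ (label-reaches ∈Tᵥ′) , walk-++ (proj₂ (label-reaches ∈Tᵥ′)) W₂))

  component-InducedTree : ∀ {w u} → Component w u → InducedTree H (Component w)
  component-InducedTree {w} {u} ∈C =
    (u , ∈C) ,
    (λ a b a∈C b∈C → walk-++ (walk-reverse (component-walk a∈C)) (component-walk b∈C)) ,
    (λ m cycle → proj₂ (proj₂ (trees v)) m
                   (InducedCycle-punchIn {P = Component w} {Q = λ y → c y ≡ c v} proj₁ cycle))

  label-neighbour : ∀ {u} (∈Tᵥ : InTreeOfV u) → punchIn v (label ∈Tᵥ) ∈ neighbours G v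
  label-neighbour ∈Tᵥ = adj⇒∈neighbours G (proj₁ (label-reaches ∈Tᵥ))

  D : ℕ
  D = ∣ neighbours G v ∣

  inner : ∀ x → InTreeOfV x → Fin D
  inner x ∈Tᵥ = rank (label-neighbour ∈Tᵥ)

  inner-trees : ∀ u ∈Tᵥ → InducedTree H (λ x → Σ (InTreeOfV x) λ ∈Tᵥ′ → inner x ∈Tᵥ′ ≡ inner u ∈Tᵥ)
  inner-trees u ∈Tᵥ = InducedTree-resp (to , from) (component-InducedTree {u = u} (∈Tᵥ , refl))
    where
    to : ∀ {x} → Component (label ∈Tᵥ) x → Σ (InTreeOfV x) λ ∈Tᵥ′ → inner x ∈Tᵥ′ ≡ inner u ∈Tᵥ
    to (∈Tᵥ′ , e) = ∈Tᵥ′ , rank-cong (label-neighbour ∈Tᵥ′) (label-neighbour ∈Tᵥ) (cong (punchIn v) e)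
    from : ∀ {x} → Σ (InTreeOfV x) (λ ∈Tᵥ′ → inner x ∈Tᵥ′ ≡ inner u ∈Tᵥ) → Component (label ∈Tᵥ) x
    from (∈Tᵥ′ , e) =
      ∈Tᵥ′ , punchIn-injective v _ _ (rank-injective (label-neighbour ∈Tᵥ′) (label-neighbour ∈Tᵥ) e)

  restrict-TreeColouring : Σ (Fin n → Fin (k + D)) (TreeColouring H)
  restrict-TreeColouring =
    join k D ∘ glue InTreeOfV? outer inner ,
    TreeColouring-kernel (cong (join k D)) (join-injective k D)
      (glue-TreeColouring InTreeOfV? outer inner (λ _ _ → punchOut-cong (c v) refl)
        (λ p q → rank-cong (label-neighbour p) (label-neighbour q) (cong (punchIn v) (label-irrelevant p q)))
        outer-trees inner-trees)

TreeCover⇒TreeColouring : ∀ {n} {G : Graph n} {k} (cover : TreeCover G k) → TreeColouring G (proj₁ cover)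
TreeCover⇒TreeColouring (c , _ , trees) u = trees (c u)

mainTheorem1 : ∀ {n} (G : Graph (suc n)) (v : Fin (suc n)) (t t' : ℕ) →
    IsTreeCoverNumber G t → IsTreeCoverNumber (delete G v) t' →
    (t ≤ t' + 1) × (t' + 1 ≤ t + deg G v)
mainTheorem1 G v zero t' ((c , _) , _) _ with c v
... | ()
mainTheorem1 {n} G v (suc k) t' isT@(cover , _) isT′@(cover′ , _) = lower , upper
  where
  open Restriction G v (proj₁ cover) (TreeCover⇒TreeColouring cover) using (D; restrict-TreeColouring)
  extended : Σ (Fin (suc n) → Fin (t' + 1)) (TreeColouring G)
  extended = extend-TreeColouring G v (proj₁ cover′) (TreeCover⇒TreeColouring cover′)

  lower : suc k ≤ t' + 1
  lower = treeCoverNumber-≤ isT extended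

  upper : t' + 1 ≤ suc k + deg G v
  upper = begin
    t' + 1          ≡⟨ +-comm t' 1 ⟩
    suc t'          ≤⟨ s≤s (treeCoverNumber-≤ isT′ restrict-TreeColouring) ⟩
    suc k + D       ≡⟨ cong (suc k +_) (∣neighbours∣≡deg G v) ⟩
    suc k + deg G v ∎
    where open ≤-Reasoning
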